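{- For every integer $q\ge 2$ there is a constant $c_q>0$ depending only on $q$ such that $S_2(q,n)\ge c_q n^{2q-1}$ for every integer $n\ge 2$.
   Context: An ordered graph is a graph on a linearly ordered vertex set. A monotone path of length $n$ is a sequence of vertices $v_1<\dots<v_n$ with $v_iv_{i+1}$ an edge for all $i$. An ordered graph is $(q,n)$-path Ramsey if every $q$-coloring of its edges contains a monochromatic monotone path of length $n$. $S_2(q,n)$ is the minimum number of edges of a $(q,n)$-path Ramsey ordered graph. -}

module Defs where

open import Data.Nat using (ℕ; suc; _<_; _<ᵇ_)
open import Data.Fin using (Fin; toℕ)
open import Data.List using (List; length; filterᵇ; cartesianProduct; allFin)
open import Data.Bool using (Bool; true; _∧_)
open import Data.Product using (_×_; _,_; Σ; ∃)
open import Relation.Binary.PropositionalEquality using (_≡_)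

-- An ordered graph on the vertex set {0,...,N-1} with its natural order.
-- Only the value of adj i j for toℕ i < toℕ j matters: the edge set is
-- { {i,j} : i < j, adj i j ≡ true }.
record OrderedGraph : Set where
  field
    N   : ℕ
    adj : Fin N → Fin N → Bool
open OrderedGraph public

edges : (G : OrderedGraph) → List (Fin (N G) × Fin (N G))
edges G = filterᵇ (λ { (i , j) → (toℕ i <ᵇ toℕ j) ∧ adj G i j })
                  (cartesianProduct (allFin (N G)) (allFin (N G)))

numEdges : OrderedGraph → ℕ
numEdges G = length (edges G)

-- A q-colouring of the edges (values on non-edges / i ≥ j are irrelevant):
-- the edge {i,j} with i < j receives colour col i j.
Colouring : ℕ → OrderedGraph → Set
Colouring q G = Fin (N G) → Fin (N G) → Fin q

-- A monotone path of length n (n vertices v 0 < v 1 < ... < v (n-1)),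
-- all of whose edges v i v (i+1) get colour c.
MonoPath : (G : OrderedGraph) {q : ℕ} → Colouring q G → Fin q → ℕ → Set
MonoPath G col c n =
  Σ (ℕ → Fin (N G)) λ v →
    ∀ i → suc i < n →
      (toℕ (v i) < toℕ (v (suc i))) × (adj G (v i) (v (suc i)) ≡ true)
        × (col (v i) (v (suc i)) ≡ c)

PathRamsey : ℕ → ℕ → OrderedGraph → Set
PathRamsey q n G = (col : Colouring q G) → ∃ λ (c : Fin q) → MonoPath G col c n

module Submission where

-- Scanning the vertices in order, a
--    greedy procedure assigns each vertex a level and a key < H + D such that
--    along every edge the level does not drop and the pair (level, key)
--    changes, while every level reached costs (H+1)·D edges.
-- 2. Colouring (Coordinates, CoordinateColouring).  Writing keys < h^r in base
--    h, a pair (level j, key) is encoded by r+1 coordinates, each ≤ j + r·g,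
--    such that every advancing step strictly increases one of them.  Colouring
--    each edge by such a coordinate, a monochromatic monotone path of length n
--    reaches level n-1-r·g.  This gives the core estimate path-Ramsey-edges:
--    if h + r·g < n and H + D ≤ h^r, the graph has at least h·(H+1)·D edges.
-- 3. Arithmetic (polynomial-bound).  Taking h ≈ n/2r and H + 1 ≈ D ≈ h^r / 2
--    yields n^(2r+1) ≤ 9·(4r)^(2r+1)·|E|; the theorem follows with
--    c_q = 1 / (1 + 9·(4r)^(2r+1)), after moving to ℚ (RationalBound).

open import Defs

module LowerBound where

  open import Data.Nat
  open import Data.Nat.Properties
  open import Data.Bool using (Bool; true; false; _∧_)
  open import Data.Bool.Properties using (T-≡)
  open import Data.List using (List; []; _∷_; length; map; lookup; _++_; filterᵇ; cartesianProduct; allFin; tabulate)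
  open import Data.List.Properties using (length-map)
  open import Data.List.Membership.Propositional using (_∈_; _∉_)
  open import Data.List.Membership.Propositional.Properties using (∈-map⁺)
  open import Data.List.Membership.DecPropositional _≟_ using (_∈?_)
  open import Data.List.Relation.Unary.Any using (here; there; index)
  open import Data.List.Relation.Unary.Any.Properties using (lookup-index)
  open import Data.Fin as Fin using (Fin; toℕ; fromℕ<; zero; suc)
  open import Data.Fin.Properties using (pigeonhole; any?; toℕ<n; fromℕ<-toℕ; toℕ-fromℕ<)
  open import Data.Product using (∃; ∃₂; _×_; _,_; proj₁; proj₂)
  open import Data.Sum using (_⊎_; inj₁; inj₂)
  open import Function.Bundles using (Equivalence)
  open import Relation.Binary.PropositionalEquality
  open import Relation.Nullary using (¬_; yes; no)
  open import Relation.Nullary.Decidable using (¬?)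
  open import Data.Empty using (⊥-elim)
  open import Data.Nat.DivMod
  open import Data.Nat.Tactic.RingSolver using (solve-∀)

  sumTo : ℕ → (ℕ → ℕ) → ℕ
  sumTo zero    f = 0
  sumTo (suc k) f = sumTo k f + f k

  indicator : Bool → ℕ
  indicator true  = 1
  indicator false = 0

  count : ℕ → (ℕ → Bool) → ℕ
  count k p = sumTo k (λ i → indicator (p i))

  sumTo-mono : ∀ n f g → (∀ i → i < n → f i ≤ g i) → sumTo n f ≤ sumTo n g
  sumTo-mono zero    f g le = z≤n
  sumTo-mono (suc n) f g le =
    +-mono-≤ (sumTo-mono n f g (λ i i<n → le i (m<n⇒m<1+n i<n))) (le n ≤-refl)

  sumTo-extend : ∀ a b f → a ≤ b → sumTo a f ≤ sumTo b f
  sumTo-extend a zero    f z≤n = ≤-refl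
  sumTo-extend a (suc b) f a≤1+b with m≤n⇒m<n∨m≡n a≤1+b
  ... | inj₁ a<1+b = ≤-trans (sumTo-extend a b f (≤-pred a<1+b)) (m≤m+n _ _)
  ... | inj₂ refl  = ≤-refl

  sumTo-+ : ∀ n f g → sumTo n (λ i → f i + g i) ≡ sumTo n f + sumTo n g
  sumTo-+ zero    f g = refl
  sumTo-+ (suc n) f g = begin
    sumTo n (λ i → f i + g i) + (f n + g n)  ≡⟨ cong (_+ (f n + g n)) (sumTo-+ n f g) ⟩
    (sumTo n f + sumTo n g) + (f n + g n)    ≡⟨ interchange (sumTo n f) (sumTo n g) (f n) (g n) ⟩
    (sumTo n f + f n) + (sumTo n g + g n)    ∎
    where
      open ≡-Reasoning
      interchange : ∀ a b c d → (a + b) + (c + d) ≡ (a + c) + (b + d)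
      interchange = solve-∀

  sumTo-shift : ∀ n f → sumTo (suc n) f ≡ f 0 + sumTo n (λ i → f (suc i))
  sumTo-shift zero    f = +-comm 0 (f 0)
  sumTo-shift (suc n) f = trans (cong (_+ f (suc n)) (sumTo-shift n f)) (+-assoc (f 0) _ _)

  sumTo-swap : ∀ a b (f : ℕ → ℕ → ℕ) →
    sumTo a (λ i → sumTo b (f i)) ≡ sumTo b (λ j → sumTo a (λ i → f i j))
  sumTo-swap zero    b f = sym (sumTo-zero b)
    where
      sumTo-zero : ∀ b → sumTo b (λ _ → 0) ≡ 0
      sumTo-zero zero    = refl
      sumTo-zero (suc b) = cong (_+ 0) (sumTo-zero b)
  sumTo-swap (suc a) b f = trans (cong (_+ sumTo b (f a)) (sumTo-swap a b f))
    (sym (sumTo-+ b (λ j → sumTo a (λ i → f i j)) (f a)))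

  indicator-mono : ∀ {a b} → (a ≡ true → b ≡ true) → indicator a ≤ indicator b
  indicator-mono {false} _ = z≤n
  indicator-mono {true}  f rewrite f refl = ≤-refl

  count-mono : ∀ k p p' → (∀ u → p u ≡ true → p' u ≡ true) → count k p ≤ count k p'
  count-mono k p p' p⇒p' = sumTo-mono k _ _ (λ u _ → indicator-mono (p⇒p' u))

  satisfying : ℕ → (ℕ → Bool) → List ℕ
  satisfying zero    p = []
  satisfying (suc k) p with p k
  ... | true  = k ∷ satisfying k p
  ... | false = satisfying k p

  length-satisfying : ∀ k p → length (satisfying k p) ≡ count k p
  length-satisfying zero    p = refl
  length-satisfying (suc k) p with p k
  ... | true  = trans (cong suc (length-satisfying k p)) (+-comm 1 (count k p))
  ... | false = trans (length-satisfying k p) (sym (+-identityʳ _))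

  ∈-satisfying : ∀ k p u → u < k → p u ≡ true → u ∈ satisfying k p
  ∈-satisfying (suc k) p u u<1+k pu with p k in pk | m<1+n⇒m<n∨m≡n u<1+k
  ... | true  | inj₂ refl = here refl
  ... | true  | inj₁ u<k  = there (∈-satisfying k p u u<k pu)
  ... | false | inj₁ u<k  = ∈-satisfying k p u u<k pu
  ... | false | inj₂ refl with () ← trans (sym pk) pu

  module Avoid (H D : ℕ) where
    avoid : List ℕ → ℕ
    avoid xs with any? {n = D} (λ x → ¬? ((H + toℕ x) ∈? xs))
    ... | yes (x , _) = H + toℕ x
    ... | no _        = H

    avoid-spec : ∀ xs → length xs < D → (avoid xs ∉ xs) × (H ≤ avoid xs) × (avoid xs < H + D)
    avoid-spec xs len<D with any? {n = D} (λ x → ¬? ((H + toℕ x) ∈? xs))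
    ... | yes (x , H+x∉xs) = H+x∉xs , m≤m+n H _ , +-monoʳ-< H (toℕ<n x)
    ... | no none = ⊥-elim (collision (pigeonhole len<D (λ x → index (all-in x))))
      where
        all-in : ∀ (x : Fin D) → (H + toℕ x) ∈ xs
        all-in x with (H + toℕ x) ∈? xs
        ... | yes p = p
        ... | no ¬p = ⊥-elim (none (x , ¬p))
        collision : ¬ ∃₂ (λ i j → i Fin.< j × index (all-in i) ≡ index (all-in j))
        collision (i , j , i<j , same) = <⇒≢ i<j (+-cancelˡ-≡ H _ _ (begin
          H + toℕ i                       ≡⟨ lookup-index (all-in i) ⟩
          lookup xs (index (all-in i))    ≡⟨ cong (lookup xs) same ⟩
          lookup xs (index (all-in j))    ≡⟨ lookup-index (all-in j) ⟨
          H + toℕ j                       ∎))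
          where open ≡-Reasoning

  -- (j', κ') advances on (j, κ): the level does not drop and the pair changes.
  -- This is what the labelling guarantees along every edge.
  Advances : ℕ → ℕ → ℕ → ℕ → Set
  Advances j κ j' κ' = j ≤ j' × ¬ (j ≡ j' × κ ≡ κ')

  advances-of-< : ∀ {j κ j' κ'} → j < j' → Advances j κ j' κ'
  advances-of-< j<j' = <⇒≤ j<j' , λ (j≡j' , _) → <⇒≢ j<j' j≡j'

  -- Coordinates of a pair (level j, key κ < h^r) with h = g+1.  Writing
  -- κ = d₀ + d₁·h + … + d_{r-1}·h^{r-1} in base h, coordinate c < r is the
  -- digit d_c and coordinate r is j + Σ_{c<r} (g ∸ d_c).
  module Coordinates (g : ℕ) where
    private
      h : ℕ
      h = suc g

    coord : (r c j κ : ℕ) → ℕ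
    coord zero    c       j κ = j
    coord (suc r) zero    j κ = κ % h
    coord (suc r) (suc c) j κ = coord r c (j + (g ∸ κ % h)) (κ / h)

    digit≤g : ∀ κ → κ % h ≤ g
    digit≤g κ = ≤-pred (m%n<n κ h)

    coord-bound : ∀ r c j κ → coord r c j κ ≤ j + r * g
    coord-bound zero    c       j κ = m≤m+n j _
    coord-bound (suc r) zero    j κ = ≤-trans (digit≤g κ) (≤-trans (m≤m+n g (r * g)) (m≤n+m _ j))
    coord-bound (suc r) (suc c) j κ = begin
      coord r c (j + (g ∸ κ % h)) (κ / h) ≤⟨ coord-bound r c _ (κ / h) ⟩
      j + (g ∸ κ % h) + r * g             ≤⟨ +-monoˡ-≤ (r * g) (+-monoʳ-≤ j (m∸n≤m g (κ % h))) ⟩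
      j + g + r * g                       ≡⟨ +-assoc j g (r * g) ⟩
      j + (g + r * g)                     ∎
      where open ≤-Reasoning

    -- The last coordinate absorbs the complement of the lowest digit.
    shifted+digit : ∀ j κ → j + (g ∸ κ % h) + κ % h ≡ j + g
    shifted+digit j κ = trans (+-assoc j _ _) (cong (j +_) (m∸n+n≡m (digit≤g κ)))

    digits-injective : ∀ κ κ' → κ % h ≡ κ' % h → κ / h ≡ κ' / h → κ ≡ κ'
    digits-injective κ κ' same% same/ = begin
      κ                 ≡⟨ m≡m%n+[m/n]*n κ h ⟩
      κ % h + κ / h * h ≡⟨ cong₂ (λ a b → a + b * h) same% same/ ⟩
      κ' % h + κ' / h * h ≡⟨ m≡m%n+[m/n]*n κ' h ⟨
      κ'                ∎
      where open ≡-Reasoning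

    -- If the lowest digit does not increase, it drops by some δ ≥ 0 and the
    -- shifted level j + (g ∸ d₀) grows by δ at least; recurse on κ / h.
    coord-separates : ∀ r j j' κ κ' → κ < h ^ r → κ' < h ^ r → Advances j κ j' κ' →
                      ∃ λ c → c ≤ r × coord r c j κ < coord r c j' κ'
    coord-separates zero j j' κ κ' κ<1 κ'<1 (j≤j' , changed) with m≤n⇒m<n∨m≡n j≤j'
    ... | inj₁ j<j' = 0 , z≤n , j<j'
    ... | inj₂ j≡j' = ⊥-elim (changed (j≡j' , trans (n<1⇒n≡0 κ<1) (sym (n<1⇒n≡0 κ'<1))))
    coord-separates (suc r) j j' κ κ' κ<h^r κ'<h^r (j≤j' , changed) with κ % h <? κ' % h
    ... | yes d<d' = 0 , z≤n , d<d'
    ... | no d≮d' with coord-separates r j₁ j₁' (κ / h) (κ' / h)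
                         (quotient< κ κ<h^r) (quotient< κ' κ'<h^r) (j₁≤j₁' , j₁-changed)
      where
        quotient< : ∀ κ → κ < h ^ suc r → κ / h < h ^ r
        quotient< κ κ< = m<n*o⇒m/o<n (subst (κ <_) (*-comm h (h ^ r)) κ<)
        d d' j₁ j₁' : ℕ
        d = κ % h
        d' = κ' % h
        j₁ = j + (g ∸ d)
        j₁' = j' + (g ∸ d')
        d'≤d : d' ≤ d
        d'≤d = ≮⇒≥ d≮d'
        j₁+d≤j₁'+d' : j₁ + d ≤ j₁' + d'
        j₁+d≤j₁'+d' = subst₂ _≤_ (sym (shifted+digit j κ)) (sym (shifted+digit j' κ')) (+-monoˡ-≤ g j≤j')
        j₁≤j₁' : j₁ ≤ j₁'
        j₁≤j₁' = +-cancelʳ-≤ d j₁ j₁' (≤-trans j₁+d≤j₁'+d' (+-monoʳ-≤ j₁' d'≤d))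
        j₁-changed : ¬ (j₁ ≡ j₁' × κ / h ≡ κ' / h)
        j₁-changed (j₁≡j₁' , same/) = changed (j≡j' , digits-injective κ κ' d≡d' same/)
          where
            d≡d' : d ≡ d'
            d≡d' = ≤-antisym (+-cancelˡ-≤ j₁ d d' (subst (λ x → j₁ + d ≤ x + d') (sym j₁≡j₁') j₁+d≤j₁'+d')) d'≤d
            j≡j' : j ≡ j'
            j≡j' = +-cancelʳ-≡ g j j'
                     (trans (sym (shifted+digit j κ)) (trans (cong₂ _+_ j₁≡j₁' d≡d') (shifted+digit j' κ')))
    ... | c , c≤r , increase = suc c , s≤s c≤r , increase

  -- Ordered graphs on ℕ are given by an adjacency A, where A u v = true means
  -- that u < v and uv is an edge.  inDegree A v counts the in-neighbours u < v.
  inDegree : (ℕ → ℕ → Bool) → ℕ → ℕ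
  inDegree A v = count v (λ u → A u v)

  edgesBefore : (ℕ → ℕ → Bool) → ℕ → ℕ
  edgesBefore A k = sumTo k (inDegree A)

  _[_≔_] : (ℕ → ℕ) → ℕ → ℕ → ℕ → ℕ
  (f [ k ≔ a ]) u with u ≟ k
  ... | yes _ = a
  ... | no _  = f u

  update-same : ∀ f k a → (f [ k ≔ a ]) k ≡ a
  update-same f k a with k ≟ k
  ... | yes _ = refl
  ... | no k≢k = ⊥-elim (k≢k refl)

  update-other : ∀ f k a u → u < k → (f [ k ≔ a ]) u ≡ f u
  update-other f k a u u<k with u ≟ k
  ... | yes refl = ⊥-elim (<-irrefl refl u<k)
  ... | no _     = refl

  update-extends : ∀ (P : ℕ → ℕ → Set) f k a → (∀ u → u < k → P u (f u)) → P k a →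
                   ∀ u → u < suc k → P u ((f [ k ≔ a ]) u)
  update-extends P f k a below at-k u u<1+k with m<1+n⇒m<n∨m≡n u<1+k
  ... | inj₁ u<k  = subst (P u) (sym (update-other f k a u u<k)) (below u u<k)
  ... | inj₂ refl = subst (P u) (sym (update-same f u a)) at-k

  -- The greedy labelling with parameters H and D = D'+1.  Vertices are
  -- processed in increasing order; a block is a maximal run of vertices
  -- sharing one level.  A vertex with fewer than D in-neighbours in the current
  -- block is light and gets a key in [H, H+D) differing from theirs.  Otherwise
  -- it is heavy and gets the next key 0, 1, …, H-1, unless H heavy vertices
  -- are already in the block: then it opens a new block (level+1, key H).
  -- Thus every block costs X = (H+1)·D edges.
  module Greedy (A : ℕ → ℕ → Bool) (H D' : ℕ) where
    D X : ℕ
    D = suc D'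
    X = suc H * D

    open Avoid H D

    -- The current level, the first vertex of the current block, the number of
    -- heavy vertices in it, and the labels assigned so far.
    record State : Set where
      field
        level start heavyCount : ℕ
        levelOf keyOf : ℕ → ℕ
    open State

    inBlock : State → ℕ → ℕ → Bool
    inBlock σ k u = (start σ ≤ᵇ u) ∧ A u k

    blockDegree : State → ℕ → ℕ
    blockDegree σ k = count k (inBlock σ k)

    blockKeys : State → ℕ → List ℕ
    blockKeys σ k = map (keyOf σ) (satisfying k (inBlock σ k))

    data Kind (σ : State) (k : ℕ) : Set where
      light   : blockDegree σ k < D → Kind σ k
      heavy   : D ≤ blockDegree σ k → heavyCount σ < H → Kind σ k
      opening : D ≤ blockDegree σ k → H ≤ heavyCount σ → Kind σ k

    kind : (σ : State) (k : ℕ) → Kind σ k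
    kind σ k with blockDegree σ k <? D | heavyCount σ <? H
    ... | yes small | _      = light small
    ... | no large  | yes t<H = heavy (≮⇒≥ large) t<H
    ... | no large  | no t≮H  = opening (≮⇒≥ large) (≮⇒≥ t≮H)

    step : (σ : State) (k : ℕ) → Kind σ k → State
    step σ k (light _) = record σ
      { levelOf = levelOf σ [ k ≔ level σ ] ; keyOf = keyOf σ [ k ≔ avoid (blockKeys σ k) ] }
    step σ k (heavy _ _) = record σ
      { heavyCount = suc (heavyCount σ)
      ; levelOf = levelOf σ [ k ≔ level σ ] ; keyOf = keyOf σ [ k ≔ heavyCount σ ] }
    step σ k (opening _ _) = record
      { level = suc (level σ) ; start = k ; heavyCount = 0
      ; levelOf = levelOf σ [ k ≔ suc (level σ) ] ; keyOf = keyOf σ [ k ≔ H ] }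

    run : ℕ → State
    run zero    = record { level = 0 ; start = 0 ; heavyCount = 0 ; levelOf = λ _ → 0 ; keyOf = λ _ → 0 }
    run (suc k) = step (run k) k (kind (run k) k)

    -- The labels of v, fixed when v is processed.
    levelAt keyAt : ℕ → ℕ
    levelAt v = levelOf (run (suc v)) v
    keyAt v = keyOf (run (suc v)) v

    blockKeys-length : ∀ σ k → length (blockKeys σ k) ≡ blockDegree σ k
    blockKeys-length σ k =
      trans (length-map (keyOf σ) (satisfying k (inBlock σ k))) (length-satisfying k (inBlock σ k))

    light-key : ∀ σ k → blockDegree σ k < D →
                avoid (blockKeys σ k) ∉ blockKeys σ k × H ≤ avoid (blockKeys σ k) × avoid (blockKeys σ k) < H + D
    light-key σ k small = avoid-spec (blockKeys σ k) (subst (_< D) (sym (blockKeys-length σ k)) small)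

    blockDegree≤inDegree : ∀ σ k → blockDegree σ k ≤ inDegree A k
    blockDegree≤inDegree σ k = count-mono k (inBlock σ k) (λ u → A u k) (λ u → right (start σ ≤ᵇ u))
      where
        right : ∀ a {b} → (a ∧ b) ≡ true → b ≡ true
        right true b≡true = b≡true

    -- Inside a block, a key is a heavy key already handed out (< t) or is ≥ H.
    Settled : ℕ → ℕ → Set
    Settled t x = x < t ⊎ H ≤ x

    -- Invariant of the state after processing the vertices below k: older
    -- blocks have lower levels, the current block shares the level, its keys
    -- are settled, and the edges seen pay for all completed blocks and for the
    -- heavy vertices of the current one.
    record Invariant (k : ℕ) (σ : State) : Set where
      field
        start≤    : start σ ≤ k
        older     : ∀ u → u < start σ → levelOf σ u < level σ
        in-block  : ∀ u → start σ ≤ u → u < k → levelOf σ u ≡ level σ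
        block-key : ∀ u → start σ ≤ u → u < k → Settled (heavyCount σ) (keyOf σ u)
        heavy≤H   : heavyCount σ ≤ H
        budget    : level σ * X + heavyCount σ * D ≤ edgesBefore A k
    open Invariant

    level≤ : ∀ {k σ} → Invariant k σ → ∀ u → u < k → levelOf σ u ≤ level σ
    level≤ {k} {σ} I u u<k with u <? start σ
    ... | yes u<s = <⇒≤ (older I u u<s)
    ... | no u≮s  = ≤-reflexive (in-block I u (≮⇒≥ u≮s) u<k)

    module JoinBlock {k σ} (I : Invariant k σ) where
      older′ : ∀ u → u < start σ → (levelOf σ [ k ≔ level σ ]) u < level σ
      older′ u u<s = subst (_< level σ) (sym (update-other _ k _ u (<-≤-trans u<s (start≤ I))))
                       (older I u u<s)

      in-block′ : ∀ u → start σ ≤ u → u < suc k → (levelOf σ [ k ≔ level σ ]) u ≡ level σ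
      in-block′ u s≤u u<1+k =
        update-extends (λ u x → start σ ≤ u → x ≡ level σ) (levelOf σ) k (level σ)
          (λ u u<k s≤u → in-block I u s≤u u<k) (λ _ → refl) u u<1+k s≤u

    invariant-light : ∀ {k σ} → Invariant k σ → (small : blockDegree σ k < D) →
                      Invariant (suc k) (step σ k (light small))
    invariant-light {k} {σ} I small = record
      { start≤ = m≤n⇒m≤1+n (start≤ I) ; older = older′ ; in-block = in-block′
      ; block-key = block-key′ ; heavy≤H = heavy≤H I
      ; budget = ≤-trans (budget I) (m≤m+n (edgesBefore A k) (inDegree A k)) }
      where
        open JoinBlock I
        block-key′ : ∀ u → start σ ≤ u → u < suc k →
                     Settled (heavyCount σ) ((keyOf σ [ k ≔ avoid (blockKeys σ k) ]) u)
        block-key′ u s≤u u<1+k =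
          update-extends (λ u x → start σ ≤ u → Settled (heavyCount σ) x) (keyOf σ) k _
            (λ u u<k s≤u → block-key I u s≤u u<k) (λ _ → inj₂ (proj₁ (proj₂ (light-key σ k small)))) u u<1+k s≤u

    invariant-heavy : ∀ {k σ} → Invariant k σ → (large : D ≤ blockDegree σ k) (t<H : heavyCount σ < H) →
                      Invariant (suc k) (step σ k (heavy large t<H))
    invariant-heavy {k} {σ} I large t<H = record
      { start≤ = m≤n⇒m≤1+n (start≤ I) ; older = older′ ; in-block = in-block′
      ; block-key = block-key′ ; heavy≤H = t<H
      ; budget = subst (_≤ edgesBefore A k + inDegree A k) (rearrange (level σ * X) (heavyCount σ * D) D)
                   (+-mono-≤ (budget I) (≤-trans large (blockDegree≤inDegree σ k))) }
      where
        open JoinBlock I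
        t = heavyCount σ
        rearrange : ∀ a b c → a + b + c ≡ a + (c + b)
        rearrange = solve-∀
        widen : ∀ {x} → Settled t x → Settled (suc t) x
        widen (inj₁ x<t) = inj₁ (m<n⇒m<1+n x<t)
        widen (inj₂ H≤x) = inj₂ H≤x
        block-key′ : ∀ u → start σ ≤ u → u < suc k → Settled (suc t) ((keyOf σ [ k ≔ t ]) u)
        block-key′ u s≤u u<1+k =
          update-extends (λ u x → start σ ≤ u → Settled (suc t) x) (keyOf σ) k t
            (λ u u<k s≤u → widen (block-key I u s≤u u<k)) (λ _ → inj₁ ≤-refl) u u<1+k s≤u

    invariant-opening : ∀ {k σ} → Invariant k σ → (large : D ≤ blockDegree σ k) (H≤t : H ≤ heavyCount σ) →
                        Invariant (suc k) (step σ k (opening large H≤t))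
    invariant-opening {k} {σ} I large H≤t = record
      { start≤ = n≤1+n k ; older = older′ ; in-block = in-block′
      ; block-key = block-key′ ; heavy≤H = z≤n
      ; budget = subst (_≤ edgesBefore A k + inDegree A k) close-block
                   (+-mono-≤ (budget I) (≤-trans large (blockDegree≤inDegree σ k))) }
      where
        ℓ = level σ
        older′ : ∀ u → u < k → (levelOf σ [ k ≔ suc ℓ ]) u < suc ℓ
        older′ u u<k = subst (_< suc ℓ) (sym (update-other _ k _ u u<k)) (s≤s (level≤ I u u<k))
        in-block′ : ∀ u → k ≤ u → u < suc k → (levelOf σ [ k ≔ suc ℓ ]) u ≡ suc ℓ
        in-block′ u k≤u u<1+k rewrite ≤-antisym (≤-pred u<1+k) k≤u = update-same _ k _
        block-key′ : ∀ u → k ≤ u → u < suc k → Settled 0 ((keyOf σ [ k ≔ H ]) u)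
        block-key′ u k≤u u<1+k rewrite ≤-antisym (≤-pred u<1+k) k≤u | update-same (keyOf σ) k H = inj₂ ≤-refl
        -- A block is closed after H heavy vertices and the opening one.
        close-block : ℓ * X + heavyCount σ * D + D ≡ suc ℓ * X + 0 * D
        close-block rewrite ≤-antisym (heavy≤H I) H≤t = closed ℓ H D
          where
            closed : ∀ ℓ H D → ℓ * ((1 + H) * D) + H * D + D ≡ (1 + ℓ) * ((1 + H) * D) + 0 * D
            closed = solve-∀

    invariant : ∀ k → Invariant k (run k)
    invariant zero = record
      { start≤ = z≤n ; older = λ _ () ; in-block = λ _ _ () ; block-key = λ _ _ ()
      ; heavy≤H = z≤n ; budget = z≤n }
    invariant (suc k) with kind (run k) k
    ... | light small       = invariant-light (invariant k) small
    ... | heavy large t<H   = invariant-heavy (invariant k) large t<H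
    ... | opening large H≤t = invariant-opening (invariant k) large H≤t

    step-keeps : ∀ σ k c u → u < k → levelOf (step σ k c) u ≡ levelOf σ u × keyOf (step σ k c) u ≡ keyOf σ u
    step-keeps σ k (light _)     u u<k = update-other _ k _ u u<k , update-other _ k _ u u<k
    step-keeps σ k (heavy _ _)   u u<k = update-other _ k _ u u<k , update-other _ k _ u u<k
    step-keeps σ k (opening _ _) u u<k = update-other _ k _ u u<k , update-other _ k _ u u<k

    stable : ∀ u k → u < k → levelOf (run k) u ≡ levelAt u × keyOf (run k) u ≡ keyAt u
    stable u (suc k) u<1+k with m<1+n⇒m<n∨m≡n u<1+k
    ... | inj₂ refl = refl , refl
    ... | inj₁ u<k with step-keeps (run k) k (kind (run k) k) u u<k | stable u k u<k
    ...   | level-kept , key-kept | level≡ , key≡ = trans level-kept level≡ , trans key-kept key≡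

    level≤new : ∀ σ k c → level σ ≤ levelOf (step σ k c) k
    level≤new σ k (light _)     = ≤-reflexive (sym (update-same _ k _))
    level≤new σ k (heavy _ _)   = ≤-reflexive (sym (update-same _ k _))
    level≤new σ k (opening _ _) = ≤-trans (n≤1+n _) (≤-reflexive (sym (update-same _ k _)))

    -- Every in-edge u → k of the vertex processed advances the labels: either
    -- u lies in an older block, or its key is among those k is made to avoid.
    step-advances : ∀ {k σ} → Invariant k σ → (c : Kind σ k) → ∀ u → u < k → A u k ≡ true →
                    Advances (levelOf σ u) (keyOf σ u) (levelOf (step σ k c) k) (keyOf (step σ k c) k)
    step-advances {k} {σ} I c u u<k edge with u <? start σ
    ... | yes u<s = advances-of-< (<-≤-trans (older I u u<s) (level≤new σ k c))
    ... | no u≮s = in-block-case c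
      where
        s≤u : start σ ≤ u
        s≤u = ≮⇒≥ u≮s
        level-u : levelOf σ u ≡ level σ
        level-u = in-block I u s≤u u<k
        key-u∈blockKeys : keyOf σ u ∈ blockKeys σ k
        key-u∈blockKeys = ∈-map⁺ (keyOf σ) (∈-satisfying k (inBlock σ k) u u<k in-block-u)
          where
            in-block-u : inBlock σ k u ≡ true
            in-block-u rewrite Equivalence.to T-≡ (≤⇒≤ᵇ s≤u) | edge = refl
        in-block-case : (c : Kind σ k) →
          Advances (levelOf σ u) (keyOf σ u) (levelOf (step σ k c) k) (keyOf (step σ k c) k)
        in-block-case (light small) =
          ≤-reflexive (trans level-u (sym (update-same _ k _))) ,
          λ (_ , key≡) → proj₁ (light-key σ k small)
                           (subst (_∈ blockKeys σ k) (trans key≡ (update-same _ k _)) key-u∈blockKeys)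
        in-block-case (heavy _ t<H) =
          ≤-reflexive (trans level-u (sym (update-same _ k _))) ,
          λ (_ , key≡) → key-u≢t (trans key≡ (update-same _ k _))
          where
            key-u≢t : keyOf σ u ≢ heavyCount σ
            key-u≢t key≡t with block-key I u s≤u u<k
            ... | inj₁ key<t = <-irrefl key≡t key<t
            ... | inj₂ H≤key = <-irrefl refl (<-≤-trans t<H (subst (H ≤_) key≡t H≤key))
        in-block-case (opening large H≤t) =
          advances-of-< (subst (_< levelOf (step σ k (opening large H≤t)) k) (sym level-u)
                          (≤-reflexive (sym (update-same _ k _))))

    advances : ∀ u v → u < v → A u v ≡ true → Advances (levelAt u) (keyAt u) (levelAt v) (keyAt v)
    advances u v u<v edge with stable u v u<v
    ... | level≡ , key≡ = subst₂ (λ j κ → Advances j κ (levelAt v) (keyAt v)) level≡ key≡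
                            (step-advances (invariant v) (kind (run v) v) u u<v edge)

    keyAt< : ∀ v → keyAt v < H + D
    keyAt< v with kind (run v) v
    ... | light small  = subst (_< H + D) (sym (update-same _ v _)) (proj₂ (proj₂ (light-key (run v) v small)))
    ... | heavy _ t<H  = subst (_< H + D) (sym (update-same _ v _)) (≤-trans t<H (m≤m+n H D))
    ... | opening _ _  = subst (_< H + D) (sym (update-same _ v _)) (m<m+n H z<s)

    levelAt-cost : ∀ v → levelAt v * X ≤ edgesBefore A (suc v)
    levelAt-cost v = begin
      levelAt v * X             ≤⟨ *-monoˡ-≤ X (level≤ I v ≤-refl) ⟩
      level σ * X               ≤⟨ m≤m+n _ _ ⟩
      level σ * X + heavyCount σ * D ≤⟨ budget I ⟩
      edgesBefore A (suc v)     ∎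
      where
        open ≤-Reasoning
        σ = run (suc v)
        I = invariant (suc v)

  Adj : OrderedGraph → ℕ → ℕ → Bool
  Adj G u v with u <? N G | v <? N G
  ... | yes u<N | yes v<N = (u <ᵇ v) ∧ adj G (fromℕ< u<N) (fromℕ< v<N)
  ... | _       | _       = false

  Adj-toℕ : ∀ G x y → Adj G (toℕ x) (toℕ y) ≡ ((toℕ x <ᵇ toℕ y) ∧ adj G x y)
  Adj-toℕ G x y with toℕ x <? N G | toℕ y <? N G
  ... | yes x<N | yes y<N rewrite fromℕ<-toℕ x x<N | fromℕ<-toℕ y y<N = refl
  ... | no x≮N  | _       = ⊥-elim (x≮N (toℕ<n x))
  ... | yes _   | no y≮N  = ⊥-elim (y≮N (toℕ<n y))

  Adj-edge : ∀ G x y → toℕ x < toℕ y → adj G x y ≡ true → Adj G (toℕ x) (toℕ y) ≡ true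
  Adj-edge G x y x<y edge = trans (Adj-toℕ G x y) (cong₂ _∧_ (Equivalence.to T-≡ (<⇒<ᵇ x<y)) edge)

  sumOver : {B : Set} → (B → ℕ) → List B → ℕ
  sumOver f []       = 0
  sumOver f (x ∷ xs) = f x + sumOver f xs

  sumOver-++ : {B : Set} (f : B → ℕ) (xs ys : List B) → sumOver f (xs ++ ys) ≡ sumOver f xs + sumOver f ys
  sumOver-++ f []       ys = refl
  sumOver-++ f (x ∷ xs) ys = trans (cong (f x +_) (sumOver-++ f xs ys)) (sym (+-assoc (f x) _ _))

  sumOver-map : {B C : Set} (f : C → ℕ) (g : B → C) (xs : List B) → sumOver f (map g xs) ≡ sumOver (λ x → f (g x)) xs
  sumOver-map f g []       = refl
  sumOver-map f g (x ∷ xs) = cong (f (g x) +_) (sumOver-map f g xs)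

  length-filterᵇ : {B : Set} (p : B → Bool) (xs : List B) → length (filterᵇ p xs) ≡ sumOver (λ x → indicator (p x)) xs
  length-filterᵇ p []       = refl
  length-filterᵇ p (x ∷ xs) with p x
  ... | true  = cong suc (length-filterᵇ p xs)
  ... | false = length-filterᵇ p xs

  sumOver-cartesianProduct : {B C : Set} (f : B × C → ℕ) (xs : List B) (ys : List C) →
    sumOver f (cartesianProduct xs ys) ≡ sumOver (λ x → sumOver (λ y → f (x , y)) ys) xs
  sumOver-cartesianProduct f []       ys = refl
  sumOver-cartesianProduct f (x ∷ xs) ys = trans (sumOver-++ f (map (x ,_) ys) _)
    (cong₂ _+_ (sumOver-map f (x ,_) ys) (sumOver-cartesianProduct f xs ys))

  sumOver-tabulate : {B : Set} (n : ℕ) (g : Fin n → B) (f : B → ℕ) (f′ : ℕ → ℕ) →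
    (∀ i → f (g i) ≡ f′ (toℕ i)) → sumOver f (tabulate g) ≡ sumTo n f′
  sumOver-tabulate zero    g f f′ agree = refl
  sumOver-tabulate (suc n) g f f′ agree = trans
    (cong₂ _+_ (agree zero) (sumOver-tabulate n (λ i → g (suc i)) f (λ i → f′ (suc i)) (λ i → agree (suc i))))
    (sym (sumTo-shift n f′))

  numEdges-double-sum : ∀ G → numEdges G ≡ sumTo (N G) (λ u → sumTo (N G) (λ v → indicator (Adj G u v)))
  numEdges-double-sum G = begin
    numEdges G                                           ≡⟨ length-filterᵇ _ (cartesianProduct vertices vertices) ⟩
    sumOver _ (cartesianProduct vertices vertices)       ≡⟨ sumOver-cartesianProduct _ vertices vertices ⟩
    sumOver (λ x → sumOver _ vertices) vertices          ≡⟨ sumOver-tabulate (N G) (λ i → i) _ _ row ⟩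
    sumTo (N G) (λ u → sumTo (N G) (λ v → indicator (Adj G u v))) ∎
    where
      open ≡-Reasoning
      vertices = allFin (N G)
      row : ∀ x → sumOver (λ y → indicator ((toℕ x <ᵇ toℕ y) ∧ adj G x y)) vertices
                ≡ sumTo (N G) (λ v → indicator (Adj G (toℕ x) v))
      row x = sumOver-tabulate (N G) (λ i → i) _ _ (λ y → cong indicator (sym (Adj-toℕ G x y)))

  -- Counting every edge at its right endpoint.
  edgesBefore≤numEdges : ∀ G → edgesBefore (Adj G) (N G) ≤ numEdges G
  edgesBefore≤numEdges G = begin
    sumTo (N G) (λ v → sumTo v (λ u → indicator (Adj G u v)))      ≤⟨ sumTo-mono (N G) _ _ widen ⟩
    sumTo (N G) (λ v → sumTo (N G) (λ u → indicator (Adj G u v)))  ≡⟨ sumTo-swap (N G) (N G) _ ⟨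
    sumTo (N G) (λ u → sumTo (N G) (λ v → indicator (Adj G u v)))  ≡⟨ numEdges-double-sum G ⟨
    numEdges G                                                      ∎
    where
      open ≤-Reasoning
      widen : ∀ v → v < N G → sumTo v (λ u → indicator (Adj G u v)) ≤ sumTo (N G) (λ u → indicator (Adj G u v))
      widen v v<N = sumTo-extend v (N G) _ (<⇒≤ v<N)

  record Labelling (G : OrderedGraph) (X m : ℕ) : Set where
    field
      level key  : ℕ → ℕ
      advances   : ∀ u v → u < v → Adj G u v ≡ true → Advances (level u) (key u) (level v) (key v)
      key<       : ∀ v → key v < m
      level-cost : ∀ v → v < N G → level v * X ≤ numEdges G

  greedy-labelling : ∀ G H D' → Labelling G (suc H * suc D') (H + suc D')
  greedy-labelling G H D' = record
    { level = levelAt ; key = keyAt ; advances = advances ; key< = keyAt<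
    ; level-cost = λ v v<N → ≤-trans (levelAt-cost v)
                     (≤-trans (sumTo-extend (suc v) (N G) _ v<N) (edgesBefore≤numEdges G)) }
    where open Greedy (Adj G) H D'

  -- Colouring the edges of G by a coordinate that increases along the edge:
  -- on a monochromatic monotone path that coordinate grows by one per step,
  -- but it never exceeds level + r·g.  Hence, if h + r·g < n with h = g+1, a
  -- (r+1, n)-path Ramsey graph has a vertex of level ≥ h and thus h·X edges.
  module CoordinateColouring {G X m} (L : Labelling G X m) (r g : ℕ) (m≤ : m ≤ suc g ^ r) where
    open Labelling L
    open Coordinates g

    Φ : Fin (suc r) → Fin (N G) → ℕ
    Φ c x = coord r (toℕ c) (level (toℕ x)) (key (toℕ x))

    colouring : Colouring (suc r) G
    colouring x y with any? (λ c → Φ c x <? Φ c y)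
    ... | yes (c , _) = c
    ... | no _        = zero

    colouring-increases : ∀ x y → ∃ (λ c → Φ c x < Φ c y) → Φ (colouring x y) x < Φ (colouring x y) y
    colouring-increases x y some with any? (λ c → Φ c x <? Φ c y)
    ... | yes (c , increase) = increase
    ... | no none            = ⊥-elim (none some)

    edge-increases : ∀ x y → toℕ x < toℕ y → adj G x y ≡ true → Φ (colouring x y) x < Φ (colouring x y) y
    edge-increases x y x<y edge with coord-separates r _ _ _ _
      (<-≤-trans (key< (toℕ x)) m≤) (<-≤-trans (key< (toℕ y)) m≤)
      (advances (toℕ x) (toℕ y) x<y (Adj-edge G x y x<y edge))
    ... | c , c≤r , increase = colouring-increases x y
          (fromℕ< (s≤s c≤r) , subst (λ c → coord r c _ _ < coord r c _ _) (sym (toℕ-fromℕ< (s≤s c≤r))) increase)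

    labelling-bound : ∀ n → suc g + r * g < n → PathRamsey (suc r) n G → suc g * X ≤ numEdges G
    labelling-bound n scale ramsey with ramsey colouring
    ... | c , v , path = begin
      suc g * X                ≤⟨ *-monoˡ-≤ X last-level ⟩
      level (toℕ (v n-1)) * X  ≤⟨ level-cost (toℕ (v n-1)) (toℕ<n (v n-1)) ⟩
      numEdges G               ∎
      where
        open ≤-Reasoning
        climbs : ∀ i → suc i < n → Φ c (v i) < Φ c (v (suc i))
        climbs i i+1<n with path i i+1<n
        ... | v<v , edge , refl = edge-increases (v i) (v (suc i)) v<v edge
        height : ∀ i → i < n → i ≤ Φ c (v i)
        height zero    _     = z≤n
        height (suc i) i+1<n = ≤-trans (s≤s (height i (<-trans (n<1+n i) i+1<n))) (climbs i i+1<n)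
        n-1 : ℕ
        n-1 = pred n
        n≡ : suc n-1 ≡ n
        n≡ = suc-pred n {{>-nonZero (<-≤-trans z<s scale)}}
        last-level : suc g ≤ level (toℕ (v n-1))
        last-level = +-cancelʳ-≤ (r * g) (suc g) _ (begin
          suc g + r * g                ≤⟨ ≤-pred (subst (suc g + r * g <_) (sym n≡) scale) ⟩
          n-1                          ≤⟨ height n-1 (subst (n-1 <_) n≡ ≤-refl) ⟩
          Φ c (v n-1)                  ≤⟨ coord-bound r (toℕ c) _ _ ⟩
          level (toℕ (v n-1)) + r * g  ∎)

  path-Ramsey-edges : ∀ {r n} G → PathRamsey (suc r) n G →
    ∀ g H D' → suc g + r * g < n → H + suc D' ≤ suc g ^ r → suc g * (suc H * suc D') ≤ numEdges G
  path-Ramsey-edges {r} {n} G ramsey g H D' scale fits =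
    CoordinateColouring.labelling-bound (greedy-labelling G H D') r g fits n scale ramsey

  halve : ∀ K → 2 ≤ K → ∃ λ D' → D' + suc D' ≤ K × K ≤ 3 * suc D'
  halve 0 ()
  halve 1 (s≤s ())
  halve 2 _ = 0 , s≤s z≤n , s≤s (s≤s z≤n)
  halve 3 _ = 0 , s≤s z≤n , ≤-refl
  halve (suc (suc (suc (suc K)))) _ with halve (suc (suc K)) (s≤s (s≤s z≤n))
  ... | D' , split≤ , K≤ = suc D' , split≤′ , K≤′
    where
      split≤′ : suc D' + suc (suc D') ≤ suc (suc (suc (suc K)))
      split≤′ rewrite +-suc D' (suc D') = s≤s (s≤s split≤)
      K≤′ : suc (suc (suc (suc K))) ≤ 3 * suc (suc D')
      K≤′ = ≤-trans (s≤s (s≤s K≤)) (≤-trans (n≤1+n _) (≤-reflexive (sym (*-suc 3 (suc D')))))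

  ^-distribʳ-* : ∀ a b e → (a * b) ^ e ≡ a ^ e * b ^ e
  ^-distribʳ-* a b zero    = refl
  ^-distribʳ-* a b (suc e) rewrite ^-distribʳ-* a b e = interchange a b (a ^ e) (b ^ e)
    where
      interchange : ∀ a b x y → a * b * (x * y) ≡ a * x * (b * y)
      interchange = solve-∀

  -- Balancing H+1 ≈ D ≈ h^r / 2: if every H + D ≤ h^r forces h·(H+1)·D ≤ E,
  -- then h^(2r+1) ≤ 9E.
  balanced-bound : ∀ r g E → 1 ≤ r → 1 ≤ g →
    (∀ H D' → H + suc D' ≤ suc g ^ r → suc g * (suc H * suc D') ≤ E) → suc g ^ suc (r + r) ≤ 9 * E
  balanced-bound r g E 1≤r 1≤g bound with halve (suc g ^ r) 2≤K
    where
      2≤K : 2 ≤ suc g ^ r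
      2≤K = ≤-trans (s≤s 1≤g) (≤-trans (≤-reflexive (sym (*-identityʳ (suc g)))) (^-monoʳ-≤ (suc g) 1≤r))
  ... | D' , split≤ , K≤ = begin
    suc g ^ suc (r + r)                      ≡⟨ cong (suc g *_) (^-distribˡ-+-* (suc g) r r) ⟩
    suc g * (K * K)                          ≤⟨ *-monoʳ-≤ (suc g) (*-mono-≤ K≤ K≤) ⟩
    suc g * (3 * suc D' * (3 * suc D'))      ≡⟨ regroup (suc g) (suc D') ⟩
    9 * (suc g * (suc D' * suc D'))          ≤⟨ *-monoʳ-≤ 9 (bound D' D' split≤) ⟩
    9 * E                                    ∎
    where
      open ≤-Reasoning
      K = suc g ^ r
      regroup : ∀ h D → h * (3 * D * (3 * D)) ≡ 9 * (h * (D * D))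
      regroup = solve-∀

  -- Choice of scale: with h = ⌊n / 2r⌋, either n ≤ 4r, or h = g+1 ≥ 2 has
  -- h + r·g < n and n ≤ 4r·h.
  choose-scale : ∀ r n → 1 ≤ r →
    n ≤ 4 * r ⊎ ∃ λ g → 1 ≤ g × suc g + r * g < n × n ≤ 4 * r * suc g
  choose-scale r@(suc _) n 1≤r = by-quotient (n / (2 * r)) (m/n*n≤m n (2 * r)) n<[1+n/2r]*2r
    where
      n<[1+n/2r]*2r : n < suc (n / (2 * r)) * (2 * r)
      n<[1+n/2r]*2r = begin-strict
        n                                   ≡⟨ m≡m%n+[m/n]*n n (2 * r) ⟩
        n % (2 * r) + n / (2 * r) * (2 * r) <⟨ +-monoˡ-< _ (m%n<n n (2 * r)) ⟩
        suc (n / (2 * r)) * (2 * r)         ∎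
        where open ≤-Reasoning
      2r≡r+r : 2 * r ≡ r + r
      2r≡r+r = cong (r +_) (+-identityʳ r)
      4r-as : ∀ r h → 2 * h * (2 * r) ≡ 4 * r * h
      4r-as = solve-∀
      by-quotient : ∀ h → h * (2 * r) ≤ n → n < suc h * (2 * r) →
                    n ≤ 4 * r ⊎ ∃ λ g → 1 ≤ g × suc g + r * g < n × n ≤ 4 * r * suc g
      2*2r≡4r : 2 * (2 * r) ≡ 4 * r
      2*2r≡4r = double-twice r
        where
          double-twice : ∀ r → 2 * (2 * r) ≡ 4 * r
          double-twice = solve-∀
      by-quotient 0 _ n<2r = inj₁ (≤-trans (<⇒≤ n<2r) (≤-trans (*-monoˡ-≤ (2 * r) (n≤1+n 1)) (≤-reflexive 2*2r≡4r)))
      by-quotient 1 _ n<4r = inj₁ (≤-trans (<⇒≤ n<4r) (≤-reflexive 2*2r≡4r))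
      by-quotient h@(suc g@(suc _)) h*2r≤n n<[1+h]*2r = inj₂ (g , s≤s z≤n , scale , n≤4rh)
        where
          open ≤-Reasoning
          scale : suc g + r * g < n
          scale = begin-strict
            suc g + r * g      <⟨ +-monoʳ-< (suc g) (*-monoʳ-< r (n<1+n g)) ⟩
            suc r * h          ≤⟨ *-monoˡ-≤ h (≤-trans (+-monoˡ-≤ r 1≤r) (≤-reflexive (sym 2r≡r+r))) ⟩
            2 * r * h          ≡⟨ *-comm (2 * r) h ⟩
            h * (2 * r)        ≤⟨ h*2r≤n ⟩
            n                  ∎
          1+h≤2h : suc h ≤ 2 * h
          1+h≤2h = ≤-trans (s≤s (m≤m+n h 0)) (+-monoˡ-≤ (h + 0) {1} {h} (s≤s z≤n))
          n≤4rh : n ≤ 4 * r * h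
          n≤4rh = begin
            n                  ≤⟨ <⇒≤ n<[1+h]*2r ⟩
            suc h * (2 * r)    ≤⟨ *-monoˡ-≤ (2 * r) 1+h≤2h ⟩
            2 * h * (2 * r)    ≡⟨ 4r-as r h ⟩
            4 * r * h          ∎

  C : ℕ → ℕ
  C r = 9 * (4 * r) ^ suc (r + r)

  polynomial-bound : ∀ r n E → 1 ≤ r → 2 ≤ n →
    (∀ g H D' → suc g + r * g < n → H + suc D' ≤ suc g ^ r → suc g * (suc H * suc D') ≤ E) →
    n ^ suc (r + r) ≤ C r * E
  polynomial-bound r n E 1≤r 2≤n bound with choose-scale r n 1≤r
  ... | inj₁ n≤4r = begin
    n ^ e          ≤⟨ ^-monoˡ-≤ e n≤4r ⟩
    (4 * r) ^ e    ≤⟨ m≤n*m _ 9 ⟩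
    C r            ≡⟨ *-identityʳ (C r) ⟨
    C r * 1        ≤⟨ *-monoʳ-≤ (C r) 1≤E ⟩
    C r * E        ∎
    where
      open ≤-Reasoning
      e = suc (r + r)
      -- The smallest scale (g = H = D' = 0) already certifies one edge.
      1≤E : 1 ≤ E
      1≤E = bound 0 0 0 (subst (λ x → 1 + x < n) (sym (*-zeroʳ r)) 2≤n) (≤-reflexive (sym (^-zeroˡ r)))
  ... | inj₂ (g , 1≤g , scale , n≤4rh) = begin
    n ^ e                    ≤⟨ ^-monoˡ-≤ e n≤4rh ⟩
    (4 * r * suc g) ^ e      ≡⟨ ^-distribʳ-* (4 * r) (suc g) e ⟩
    (4 * r) ^ e * suc g ^ e  ≤⟨ *-monoʳ-≤ ((4 * r) ^ e) (balanced-bound r g E 1≤r 1≤g (λ H D' → bound g H D' scale)) ⟩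
    (4 * r) ^ e * (9 * E)    ≡⟨ regroup ((4 * r) ^ e) E ⟩
    C r * E                  ∎
    where
      open ≤-Reasoning
      e = suc (r + r)
      regroup : ∀ a E → a * (9 * E) ≡ 9 * a * E
      regroup = solve-∀

  exponent : ∀ r → 2 * suc r ∸ 1 ≡ suc (r + r)
  exponent r = trans (cong (r +_) (+-identityʳ (suc r))) (+-suc r r)

module RationalBound where

  open import Data.Nat as ℕ using (suc)
  import Data.Nat.Properties as ℕ
  open import Data.Integer as ℤ using (+_; +≤+)
  import Data.Integer.Properties as ℤ
  open import Data.Rational using (0ℚ; _<_; _≤_; _/_; _*_; fromℚᵘ)
  open import Data.Rational.Properties using (toℚᵘ-cancel-≤; toℚᵘ-homo-*; toℚᵘ-fromℚᵘ; normalize-pos; positive⁻¹)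
  open import Data.Rational.Unnormalised as U using (mkℚᵘ; *≤*)
  import Data.Rational.Unnormalised.Properties as U
  open import Relation.Binary.PropositionalEquality

  1/1+c>0 : ∀ c → 0ℚ < (+ 1 / suc c)
  1/1+c>0 c = positive⁻¹ _ {{normalize-pos 1 (suc c)}}

  -- a ≤ (c+1)·b in ℕ gives a/(c+1) ≤ b in ℚ; checked on unnormalised fractions.
  scale-down : ∀ c a b → a ℕ.≤ suc c ℕ.* b → (+ 1 / suc c) * (+ a / 1) ≤ (+ b / 1)
  scale-down c a b a≤[1+c]b = toℚᵘ-cancel-≤
    (U.≤-respˡ-≃ (U.≃-sym (U.≃-trans (toℚᵘ-homo-* (fromℚᵘ u) (fromℚᵘ x)) (U.*-cong (toℚᵘ-fromℚᵘ u) (toℚᵘ-fromℚᵘ x))))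
      (U.≤-respʳ-≃ (U.≃-sym (toℚᵘ-fromℚᵘ y)) unnormalised))
    where
      u = mkℚᵘ (+ 1) c
      x = mkℚᵘ (+ a) 0
      y = mkℚᵘ (+ b) 0
      lhs : + a ≡ (+ 1 ℤ.* + a) ℤ.* + 1
      lhs = sym (trans (ℤ.*-identityʳ _) (ℤ.*-identityˡ _))
      rhs : + (suc c ℕ.* b) ≡ + b ℤ.* + (suc c ℕ.* 1)
      rhs = trans (cong +_ (trans (ℕ.*-comm (suc c) b) (cong (b ℕ.*_) (sym (ℕ.*-identityʳ (suc c))))))
                  (ℤ.pos-* b (suc c ℕ.* 1))
      unnormalised : (u U.* x) U.≤ y
      unnormalised = *≤* (subst₂ ℤ._≤_ lhs rhs (+≤+ a≤[1+c]b))

open import Data.Nat using (ℕ; _^_; _∸_; suc; s≤s) renaming (_≤_ to _≤ℕ_; _*_ to _*ℕ_)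
open import Data.Integer using (+_)
open import Data.Product using (Σ; _×_; _,_)
open import Data.Rational using (ℚ; 0ℚ; _<_; _≤_; _/_; _*_)
open import Data.Nat.Properties using (≤-trans; m≤n+m)
open import Relation.Binary.PropositionalEquality using (subst; sym)
open LowerBound using (path-Ramsey-edges; polynomial-bound; C; exponent)
open RationalBound using (1/1+c>0; scale-down)

corollary2 : (q : ℕ) → 2 ≤ℕ q →
    Σ ℚ λ c → (0ℚ < c) ×
      ((n : ℕ) → 2 ≤ℕ n → (G : OrderedGraph) → PathRamsey q n G →
        c * ((+ (n ^ (2 *ℕ q ∸ 1))) / 1) ≤ ((+ numEdges G) / 1))
corollary2 (suc r) (s≤s 1≤r) = + 1 / suc (C r) , 1/1+c>0 (C r) , bound
  where
    bound : (n : ℕ) → 2 ≤ℕ n → (G : OrderedGraph) → PathRamsey (suc r) n G →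
            (+ 1 / suc (C r)) * ((+ (n ^ (2 *ℕ suc r ∸ 1))) / 1) ≤ ((+ numEdges G) / 1)
    bound n 2≤n G ramsey = scale-down (C r) _ (numEdges G)
      (subst (λ e → n ^ e ≤ℕ suc (C r) *ℕ numEdges G) (sym (exponent r))
        (≤-trans (polynomial-bound r n (numEdges G) 1≤r 2≤n (path-Ramsey-edges G ramsey))
                 (m≤n+m (C r *ℕ numEdges G) (numEdges G))))
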